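{- Let $p\ge3$, $n\ge0$ be integers. If $u,v$ are adjacent vertices of $H_p^n$ with $o(u)\le o(v)$, then \[ \deg(u)=\begin{cases}\deg(v), & \text{if } o(u)=o(v),\\ \deg(v)-(p-o(v)), & \text{if } o(v)=o(u)+1.\end{cases} \]
   Context: For integers $p\ge 3$, $n\ge 0$, let $[p]_0=\{0,\dots,p-1\}$. The generalized Hanoi graph $H_p^n$ has vertex set $[p]_0^n$: a vertex $s=s_n\cdots s_1$ encodes a state of the Tower of Hanoi with $p$ pegs and $n$ discs of sizes $1<\dots<n$, disc $d$ lying on peg $s_d$. Two vertices are adjacent iff they have the form $\underline{s}\,i\,\overline{s}$ and $\underline{s}\,j\,\overline{s}$ with $i\ne j$, $\underline{s}\in[p]_0^{n-d}$, $\overline{s}\in([p]_0\setminus\{i,j\})^{d-1}$ for some $d$. The occupancy $o(s)$ is the number of pegs holding at least one disc in state $s$. -}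

module Defs where

open import Data.Nat using (ℕ; zero; suc)
open import Data.Fin using (Fin)
open import Data.Fin.Properties using (_≟_)
open import Data.Vec using (Vec; []; _∷_)
open import Data.Vec.Properties using (≡-dec)
open import Data.Vec.Relation.Unary.All using (All; all?)
open import Data.Vec.Relation.Unary.Any using (Any; any?)
open import Data.List using (List; length; filter; map; concatMap; [_])
open import Data.List.Base using (allFin)
open import Data.Product using (_×_; _,_)
open import Relation.Nullary using (¬_; Dec; yes; no)
open import Relation.Nullary.Decidable using (_×-dec_; ¬?)
open import Relation.Binary.PropositionalEquality using (_≡_; _≢_; refl)

-- A vertex of H_p^n: a state s = s_n ⋯ s_1, stored as a vector whose
-- head is s_n (the largest disc) and whose last entry is s_1.
Vertex : ℕ → ℕ → Set
Vertex p n = Vec (Fin p) n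

-- Adjacency:  s̲ i s̄  ~  s̲ j s̄  with i ≢ j and every entry of s̄ ∉ {i, j}.
-- The prefix s̲ is peeled off one (larger) disc at a time by `there`.
data Adj {p : ℕ} : {n : ℕ} → Vertex p n → Vertex p n → Set where
  here  : ∀ {n} {i j : Fin p} {s : Vertex p n} →
          i ≢ j → All (λ x → x ≢ i × x ≢ j) s → Adj (i ∷ s) (j ∷ s)
  there : ∀ {n} {x : Fin p} {s t : Vertex p n} →
          Adj s t → Adj (x ∷ s) (x ∷ t)

adj? : ∀ {p n} (s t : Vertex p n) → Dec (Adj s t)
adj? [] [] = no (λ ())
adj? (x ∷ s) (y ∷ t) with x ≟ y
... | yes refl with adj? s t
...   | yes a = yes (there a)
...   | no ¬a = no λ { (here x≢x _) → x≢x refl ; (there a) → ¬a a }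
adj? (x ∷ s) (y ∷ t) | no x≢y with ≡-dec _≟_ s t
...   | no s≢t = no λ { (here _ _) → s≢t refl ; (there _) → x≢y refl }
...   | yes refl with all? (λ z → ¬? (z ≟ x) ×-dec ¬? (z ≟ y)) s
...     | yes al = yes (here x≢y al)
...     | no ¬al = no λ { (here _ al) → ¬al al ; (there _) → x≢y refl }

allVertices : (p n : ℕ) → List (Vertex p n)
allVertices p zero    = [ [] ]
allVertices p (suc n) = concatMap (λ i → map (i ∷_) (allVertices p n)) (allFin p)

deg : ∀ {p n} → Vertex p n → ℕ
deg {p} {n} s = length (filter (adj? s) (allVertices p n))

-- Occupancy: number of pegs k holding at least one disc (k occurs in s).
occ : ∀ {p n} → Vertex p n → ℕ
occ {p} s = length (filter (λ k → any? (k ≟_) s) (allFin p))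

-- The degree of a state depends only on its occupancy:
-- deg s = Σ_{k=1}^{o(s)} (p − k).  In a state x s̄, where x is the peg of the
-- largest disc, the neighbours are those of s̄ with x prepended, together with
-- the moves of the largest disc.  These exist only when no smaller disc lies
-- on peg x, i.e. when o(x s̄) = o(s̄) + 1, and then lead to each of the
-- p − o(x s̄) pegs empty in x s̄; otherwise o(x s̄) = o(s̄).
module Submission where

open import Defs
open import Data.Nat using (ℕ; zero; suc; _+_; _*_; _∸_; _≤_)
open import Data.Nat.Properties using (+-identityʳ; *-identityʳ; +-suc; m+n∸m≡n)
open import Data.Fin using (Fin)
open import Data.Fin.Properties using (_≟_)
open import Data.List using (List; []; _∷_; _++_; length; filter; map; concatMap)
open import Data.List.Base using (allFin)
open import Data.List.Properties using (filter-≐; filter-++; filter-none; length-++; length-tabulate)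
import Data.List.Relation.Unary.All as ListAll
open import Data.List.Relation.Unary.Any using () renaming (here to hereₗ; there to thereₗ)
open import Data.List.Relation.Unary.AllPairs using ([]; _∷_)
open import Data.List.Relation.Unary.Unique.Propositional using (Unique)
open import Data.List.Relation.Unary.Unique.Propositional.Properties using (allFin⁺)
open import Data.List.Membership.Propositional using () renaming (_∈_ to _∈ₗ_)
open import Data.List.Membership.Propositional.Properties using (∈-allFin)
open import Data.Vec using (Vec; []; _∷_; head; tail)
open import Data.Vec.Properties using (≡-dec)
open import Data.Vec.Relation.Unary.All using (All; []; _∷_; all?)
open import Data.Vec.Relation.Unary.Any using (here; there; any?)
open import Data.Vec.Membership.Propositional using (_∈_; _∉_)
open import Data.Product using (_×_; _,_; proj₁; proj₂)
open import Data.Sum using (_⊎_; inj₁; inj₂)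
open import Function using (_∘_)
open import Relation.Nullary using (¬_; Dec; yes; no)
open import Relation.Nullary.Decidable using (¬?; _×-dec_)
open import Relation.Unary using (Pred; Decidable; _≐_; _∪_)
open import Relation.Unary.Properties using (∁?; _∪?_)
open import Relation.Binary.Definitions using (DecidableEquality)
open import Relation.Binary.PropositionalEquality
  using (_≡_; _≢_; refl; sym; trans; cong; cong₂; ≢-sym; module ≡-Reasoning)
open import Data.Empty using (⊥-elim)
open import Level using (0ℓ)

count : {A : Set} {P : Pred A 0ℓ} → Decidable P → List A → ℕ
count P? xs = length (filter P? xs)

module _ {A : Set} where

  count-≐ : {P Q : Pred A 0ℓ} (P? : Decidable P) (Q? : Decidable Q) →
            P ≐ Q → ∀ xs → count P? xs ≡ count Q? xs
  count-≐ P? Q? P≐Q xs = cong length (filter-≐ P? Q? P≐Q xs)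

  count-none : {P : Pred A 0ℓ} (P? : Decidable P) → (∀ x → ¬ P x) → ∀ xs → count P? xs ≡ 0
  count-none P? ¬P xs = cong length (filter-none P? (ListAll.universal ¬P xs))

  count-++ : {P : Pred A 0ℓ} (P? : Decidable P) → ∀ xs ys →
             count P? (xs ++ ys) ≡ count P? xs + count P? ys
  count-++ P? xs ys = trans (cong length (filter-++ P? xs ys)) (length-++ (filter P? xs))

  count-∪ : {P Q : Pred A 0ℓ} (P? : Decidable P) (Q? : Decidable Q) →
            (∀ {x} → P x → ¬ Q x) → ∀ xs → count (P? ∪? Q?) xs ≡ count P? xs + count Q? xs
  count-∪ P? Q? disjoint [] = refl
  count-∪ P? Q? disjoint (x ∷ xs) with P? x | Q? x
  ... | yes px | yes qx = ⊥-elim (disjoint px qx)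
  ... | yes _  | no _   = cong suc (count-∪ P? Q? disjoint xs)
  ... | no _   | yes _  = trans (cong suc (count-∪ P? Q? disjoint xs)) (sym (+-suc _ _))
  ... | no _   | no _   = count-∪ P? Q? disjoint xs

  count+count-∁ : {P : Pred A 0ℓ} (P? : Decidable P) → ∀ xs →
                  count P? xs + count (∁? P?) xs ≡ length xs
  count+count-∁ P? [] = refl
  count+count-∁ P? (x ∷ xs) with P? x
  ... | yes _ = cong suc (count+count-∁ P? xs)
  ... | no _  = trans (+-suc _ _) (cong suc (count+count-∁ P? xs))

count-map : {A B : Set} {P : Pred B 0ℓ} (P? : Decidable P) (f : A → B) → ∀ xs →
            count P? (map f xs) ≡ count (P? ∘ f) xs
count-map P? f [] = refl
count-map P? f (x ∷ xs) with P? (f x)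
... | yes _ = cong suc (count-map P? f xs)
... | no _  = count-map P? f xs

count-cons-× : {A : Set} {n : ℕ} {Q : Pred A 0ℓ} {R : Pred (Vec A n) 0ℓ}
               (Q? : Decidable Q) (R? : Decidable R) (as : List A) (vs : List (Vec A n)) →
               count (λ v → Q? (head v) ×-dec R? (tail v)) (concatMap (λ a → map (a ∷_) vs) as)
                 ≡ count Q? as * count R? vs
count-cons-× Q? R? [] vs = refl
count-cons-× Q? R? (a ∷ as) vs = begin
  count QR? (map (a ∷_) vs ++ rest)
    ≡⟨ count-++ QR? (map (a ∷_) vs) rest ⟩
  count QR? (map (a ∷_) vs) + count QR? rest
    ≡⟨ cong₂ _+_ (count-map QR? (a ∷_) vs) (count-cons-× Q? R? as vs) ⟩
  count (λ v → Q? a ×-dec R? v) vs + count Q? as * count R? vs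
    ≡⟨ row ⟩
  count Q? (a ∷ as) * count R? vs ∎
  where
  open ≡-Reasoning
  QR? = λ v → Q? (head v) ×-dec R? (tail v)
  rest = concatMap (λ a → map (a ∷_) vs) as
  row : count (λ v → Q? a ×-dec R? v) vs + count Q? as * count R? vs
        ≡ count Q? (a ∷ as) * count R? vs
  row with Q? a
  ... | yes qa = cong (_+ _) (count-≐ _ R? (proj₂ , (qa ,_)) vs)
  ... | no ¬qa = cong (_+ _) (count-none _ (λ _ → ¬qa ∘ proj₁) vs)

count-≡-unique : {A : Set} (_≟ₐ_ : DecidableEquality A) {a : A} {xs : List A} →
                 Unique xs → a ∈ₗ xs → count (_≟ₐ a) xs ≡ 1
count-≡-unique _≟ₐ_ {a} {x ∷ xs} (x≢xs ∷ unique) a∈ with x ≟ₐ a | a∈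
... | yes refl | _           = cong suc (cong length (filter-none (_≟ₐ x) (ListAll.map ≢-sym x≢xs)))
... | no x≢a   | hereₗ refl  = ⊥-elim (x≢a refl)
... | no _     | thereₗ a∈xs = count-≡-unique _≟ₐ_ unique a∈xs

count-≡-allFin : {p : ℕ} (a : Fin p) → count (_≟ a) (allFin p) ≡ 1
count-≡-allFin {p} a = count-≡-unique _≟_ (allFin⁺ p) (∈-allFin a)

_≟ᵥ_ : {p n : ℕ} → DecidableEquality (Vertex p n)
_≟ᵥ_ = ≡-dec _≟_

count-≡-allVertices : {p n : ℕ} (s : Vertex p n) → count (_≟ᵥ s) (allVertices p n) ≡ 1
count-≡-allVertices {p} {zero} [] = refl
count-≡-allVertices {p} {suc n} (a ∷ s) = begin
  count (_≟ᵥ (a ∷ s)) (allVertices p (suc n))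
    ≡⟨ count-≐ (_≟ᵥ (a ∷ s)) headTail? ((λ { refl → refl , refl }) , (λ { {_ ∷ _} (refl , refl) → refl }))
               (allVertices p (suc n)) ⟩
  count headTail? (allVertices p (suc n))
    ≡⟨ count-cons-× (_≟ a) (_≟ᵥ s) (allFin p) (allVertices p n) ⟩
  count (_≟ a) (allFin p) * count (_≟ᵥ s) (allVertices p n)
    ≡⟨ cong₂ _*_ (count-≡-allFin a) (count-≡-allVertices s) ⟩
  1 ∎
  where
  open ≡-Reasoning
  headTail? : Decidable (λ (v : Vertex p (suc n)) → head v ≡ a × tail v ≡ s)
  headTail? v = (head v ≟ a) ×-dec (tail v ≟ᵥ s)

-- Chosen so that occ s is definitionally count (_∈? s) (allFin p).
_∈?_ : {p n : ℕ} (x : Fin p) (s : Vertex p n) → Dec (x ∈ s)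
x ∈? s = any? (x ≟_) s

module _ {A : Set} {x i : A} where

  avoids⇒∉ : ∀ {n} {s : Vec A n} → All (λ z → z ≢ x × z ≢ i) s → x ∉ s × i ∉ s
  avoids⇒∉ []                    = (λ ()) , (λ ())
  avoids⇒∉ ((z≢x , z≢i) ∷ avoid) with avoids⇒∉ avoid
  ... | x∉s , i∉s = (λ { (here refl) → z≢x refl ; (there x∈s) → x∉s x∈s })
                  , (λ { (here refl) → z≢i refl ; (there i∈s) → i∉s i∈s })

  ∉⇒avoids : ∀ {n} {s : Vec A n} → x ∉ s → i ∉ s → All (λ z → z ≢ x × z ≢ i) s
  ∉⇒avoids {s = []}    _   _   = []
  ∉⇒avoids {s = z ∷ s} x∉s i∉s =
    (x∉s ∘ here ∘ sym , i∉s ∘ here ∘ sym) ∷ ∉⇒avoids (x∉s ∘ there) (i∉s ∘ there)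

LargestDiscTarget : {p n : ℕ} → Fin p → Vertex p n → Pred (Fin p) 0ℓ
LargestDiscTarget x s i = x ≢ i × All (λ z → z ≢ x × z ≢ i) s

largestDiscTarget? : {p n : ℕ} (x : Fin p) (s : Vertex p n) → Decidable (LargestDiscTarget x s)
largestDiscTarget? x s i = ¬? (x ≟ i) ×-dec all? (λ z → ¬? (z ≟ x) ×-dec ¬? (z ≟ i)) s

module _ {p n : ℕ} (x : Fin p) (s : Vertex p n) where

  SmallerDiscMove : Pred (Vertex p (suc n)) 0ℓ
  SmallerDiscMove t = head t ≡ x × Adj s (tail t)

  smallerDiscMove? : Decidable SmallerDiscMove
  smallerDiscMove? t = (head t ≟ x) ×-dec adj? s (tail t)

  LargestDiscMove : Pred (Vertex p (suc n)) 0ℓ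
  LargestDiscMove t = LargestDiscTarget x s (head t) × tail t ≡ s

  largestDiscMove? : Decidable LargestDiscMove
  largestDiscMove? t = largestDiscTarget? x s (head t) ×-dec (tail t ≟ᵥ s)

  Adj-∷ : Adj (x ∷ s) ≐ SmallerDiscMove ∪ LargestDiscMove
  Adj-∷ = to , from
    where
    to : ∀ {t} → Adj (x ∷ s) t → SmallerDiscMove t ⊎ LargestDiscMove t
    to (here x≢i avoid) = inj₂ ((x≢i , avoid) , refl)
    to (there adj)      = inj₁ (refl , adj)
    from : ∀ {t} → SmallerDiscMove t ⊎ LargestDiscMove t → Adj (x ∷ s) t
    from {_ ∷ _} (inj₁ (refl , adj))             = there adj
    from {_ ∷ _} (inj₂ ((x≢i , avoid) , refl)) = here x≢i avoid

  deg-∷ : deg (x ∷ s) ≡ deg s + count (largestDiscTarget? x s) (allFin p)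
  deg-∷ = begin
    deg (x ∷ s)
      ≡⟨ count-≐ (adj? (x ∷ s)) (smallerDiscMove? ∪? largestDiscMove?) Adj-∷ vertices ⟩
    count (smallerDiscMove? ∪? largestDiscMove?) vertices
      ≡⟨ count-∪ smallerDiscMove? largestDiscMove? (λ { (refl , _) ((x≢x , _) , _) → x≢x refl }) vertices ⟩
    count smallerDiscMove? vertices + count largestDiscMove? vertices
      ≡⟨ cong₂ _+_ (count-cons-× (_≟ x) (adj? s) (allFin p) (allVertices p n))
                   (count-cons-× (largestDiscTarget? x s) (_≟ᵥ s) (allFin p) (allVertices p n)) ⟩
    count (_≟ x) (allFin p) * deg s + targets * count (_≟ᵥ s) (allVertices p n)
      ≡⟨ cong₂ _+_ (cong (_* deg s) (count-≡-allFin x)) (cong (targets *_) (count-≡-allVertices s)) ⟩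
    deg s + 0 + targets * 1
      ≡⟨ cong₂ _+_ (+-identityʳ (deg s)) (*-identityʳ targets) ⟩
    deg s + targets ∎
    where
    open ≡-Reasoning
    vertices = allVertices p (suc n)
    targets  = count (largestDiscTarget? x s) (allFin p)

occ-[] : {p : ℕ} → occ {p} [] ≡ 0
occ-[] {p} = count-none (_∈? []) (λ _ ()) (allFin p)

occ-∷-∈ : {p n : ℕ} {x : Fin p} {s : Vertex p n} → x ∈ s → occ (x ∷ s) ≡ occ s
occ-∷-∈ {p} {x = x} {s} x∈s =
  count-≐ (_∈? (x ∷ s)) (_∈? s) ((λ { (here refl) → x∈s ; (there k∈s) → k∈s }) , there) (allFin p)

occ-∷-∉ : {p n : ℕ} {x : Fin p} {s : Vertex p n} → x ∉ s → occ (x ∷ s) ≡ suc (occ s)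
occ-∷-∉ {p} {x = x} {s} x∉s = begin
  occ (x ∷ s)
    ≡⟨ count-≐ (_∈? (x ∷ s)) ((_≟ x) ∪? (_∈? s)) (to , from) (allFin p) ⟩
  count ((_≟ x) ∪? (_∈? s)) (allFin p)
    ≡⟨ count-∪ (_≟ x) (_∈? s) (λ { refl → x∉s }) (allFin p) ⟩
  count (_≟ x) (allFin p) + occ s
    ≡⟨ cong (_+ occ s) (count-≡-allFin x) ⟩
  suc (occ s) ∎
  where
  open ≡-Reasoning
  to : ∀ {k} → k ∈ x ∷ s → k ≡ x ⊎ k ∈ s
  to (here k≡x)  = inj₁ k≡x
  to (there k∈s) = inj₂ k∈s
  from : ∀ {k} → k ≡ x ⊎ k ∈ s → k ∈ x ∷ s
  from (inj₁ k≡x) = here k≡x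
  from (inj₂ k∈s) = there k∈s

count-largestDiscTarget-∈ : {p n : ℕ} {x : Fin p} {s : Vertex p n} → x ∈ s →
                            count (largestDiscTarget? x s) (allFin p) ≡ 0
count-largestDiscTarget-∈ {p} x∈s =
  count-none (largestDiscTarget? _ _) (λ _ target → proj₁ (avoids⇒∉ (proj₂ target)) x∈s) (allFin p)

-- The pegs left empty by s are x itself and the targets of the largest disc.
count-largestDiscTarget-∉ : {p n : ℕ} {x : Fin p} {s : Vertex p n} → x ∉ s →
                            count (largestDiscTarget? x s) (allFin p) ≡ p ∸ suc (occ s)
count-largestDiscTarget-∉ {p} {x = x} {s} x∉s = begin
  targets                           ≡⟨ m+n∸m≡n (occ s) targets ⟨
  occ s + targets ∸ occ s           ≡⟨ cong (_∸ suc (occ s)) (+-suc (occ s) targets) ⟨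
  occ s + suc targets ∸ suc (occ s) ≡⟨ cong (λ k → occ s + k ∸ suc (occ s)) empty≡1+targets ⟨
  occ s + empty ∸ suc (occ s)       ≡⟨ cong (_∸ suc (occ s)) occ+empty≡p ⟩
  p ∸ suc (occ s)                   ∎
  where
  open ≡-Reasoning
  target? = largestDiscTarget? x s
  targets = count target? (allFin p)
  empty   = count (∁? (_∈? s)) (allFin p)

  occ+empty≡p : occ s + empty ≡ p
  occ+empty≡p = trans (count+count-∁ (_∈? s) (allFin p)) (length-tabulate (λ i → i))

  to : ∀ {i} → i ∉ s → i ≡ x ⊎ LargestDiscTarget x s i
  to {i} i∉s with i ≟ x
  ... | yes i≡x = inj₁ i≡x
  ... | no i≢x  = inj₂ (≢-sym i≢x , ∉⇒avoids x∉s i∉s)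
  from : ∀ {i} → i ≡ x ⊎ LargestDiscTarget x s i → i ∉ s
  from (inj₁ refl)        = x∉s
  from (inj₂ (_ , avoid)) = proj₂ (avoids⇒∉ avoid)

  empty≡1+targets : empty ≡ suc targets
  empty≡1+targets = begin
    empty
      ≡⟨ count-≐ (∁? (_∈? s)) ((_≟ x) ∪? target?) (to , from) (allFin p) ⟩
    count ((_≟ x) ∪? target?) (allFin p)
      ≡⟨ count-∪ (_≟ x) target? (λ { refl (x≢x , _) → x≢x refl }) (allFin p) ⟩
    count (_≟ x) (allFin p) + targets
      ≡⟨ cong (_+ targets) (count-≡-allFin x) ⟩
    suc targets ∎

hanoiDegree : ℕ → ℕ → ℕ
hanoiDegree p zero    = 0
hanoiDegree p (suc o) = hanoiDegree p o + (p ∸ suc o)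

deg≡hanoiDegree∘occ : {p n : ℕ} (s : Vertex p n) → deg s ≡ hanoiDegree p (occ s)
deg≡hanoiDegree∘occ {p} []      = cong (hanoiDegree p) (sym (occ-[] {p}))
deg≡hanoiDegree∘occ {p} (x ∷ s) with x ∈? s
... | yes x∈s = begin
  deg (x ∷ s)                    ≡⟨ deg-∷ x s ⟩
  deg s + targets                ≡⟨ cong₂ _+_ (deg≡hanoiDegree∘occ s) (count-largestDiscTarget-∈ x∈s) ⟩
  hanoiDegree p (occ s) + 0      ≡⟨ +-identityʳ _ ⟩
  hanoiDegree p (occ s)          ≡⟨ cong (hanoiDegree p) (occ-∷-∈ x∈s) ⟨
  hanoiDegree p (occ (x ∷ s))    ∎
  where
  open ≡-Reasoning
  targets = count (largestDiscTarget? x s) (allFin p)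
... | no x∉s = begin
  deg (x ∷ s)                    ≡⟨ deg-∷ x s ⟩
  deg s + targets                ≡⟨ cong₂ _+_ (deg≡hanoiDegree∘occ s) (count-largestDiscTarget-∉ x∉s) ⟩
  hanoiDegree p (suc (occ s))    ≡⟨ cong (hanoiDegree p) (occ-∷-∉ x∉s) ⟨
  hanoiDegree p (occ (x ∷ s))    ∎
  where
  open ≡-Reasoning
  targets = count (largestDiscTarget? x s) (allFin p)

-- The degree depends on the occupancy alone.
mainTheorem14 : (p n : ℕ) → 3 ≤ p → (u v : Vertex p n) → Adj u v →
    occ u ≤ occ v →
    (occ u ≡ occ v → deg u ≡ deg v) ×
    (occ v ≡ suc (occ u) → deg u + (p ∸ occ v) ≡ deg v)
mainTheorem14 p n _ u v _ _ = sameOcc , nextOcc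
  where
  open ≡-Reasoning
  sameOcc : occ u ≡ occ v → deg u ≡ deg v
  sameOcc u≡v = begin
    deg u                 ≡⟨ deg≡hanoiDegree∘occ u ⟩
    hanoiDegree p (occ u) ≡⟨ cong (hanoiDegree p) u≡v ⟩
    hanoiDegree p (occ v) ≡⟨ deg≡hanoiDegree∘occ v ⟨
    deg v                 ∎
  nextOcc : occ v ≡ suc (occ u) → deg u + (p ∸ occ v) ≡ deg v
  nextOcc v≡1+u = begin
    deg u + (p ∸ occ v)                       ≡⟨ cong₂ _+_ (deg≡hanoiDegree∘occ u) (cong (p ∸_) v≡1+u) ⟩
    hanoiDegree p (occ u) + (p ∸ suc (occ u)) ≡⟨⟩
    hanoiDegree p (suc (occ u))               ≡⟨ cong (hanoiDegree p) v≡1+u ⟨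
    hanoiDegree p (occ v)                     ≡⟨ deg≡hanoiDegree∘occ v ⟨
    deg v                                     ∎
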